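{- For any integer $s\geq 2$, let $\theta(2^{[s-1]},4)$ denote the bridge graph consisting of $s-1$ internally disjoint $(u,v)$-paths of length $2$ together with one further internally disjoint $(u,v)$-path of length $4$. Then $\chi_{la}(\theta(2^{[s-1]}, 4))=3$.
   Context: For a connected graph $G=(V,E)$, a local antimagic labeling is a bijection $f:E\to\{1,\dots,|E|\}$ such that $f^+(x)\neq f^+(y)$ for every pair of adjacent vertices $x,y$, where $f^+(x)=\sum_{e\ni x} f(e)$ is the sum of labels of edges incident to $x$. The number of distinct values of $f^+$ is the color number $c(f)$, and the local antimagic chromatic number $\chi_{la}(G)$ is the minimum of $c(f)$ over all local antimagic labelings $f$ of $G$. A bridge graph ($s$-bridge graph) $\theta(a_1,\dots,a_s)$, $s\ge 2$, consists of two vertices $u,v$ joined by $s$ internally disjoint (edge-disjoint) $(u,v)$-paths of lengths $a_1,\dots,a_s$. The notation $a^{[n]}$ denotes $n$ consecutive entries equal to $a$. -}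

module Defs where

open import Data.Nat using (ℕ; zero; suc; _+_; _∸_; _≤_; _≟_)
open import Data.Fin using (Fin; toℕ)
open import Data.List using (List; []; _∷_; _++_; length; map; upTo; allFin; lookup; deduplicate; replicate)
open import Data.Product using (_×_; _,_; proj₁; proj₂; Σ; ∃)
open import Data.Bool using (Bool; if_then_else_; _∨_)
open import Relation.Nullary using (¬_)
open import Relation.Nullary.Decidable using (⌊_⌋)
open import Relation.Binary.PropositionalEquality using (_≡_)
open import Function.Definitions using (Bijective)
open import Data.Nat.ListAction using (sum)

-- A finite (multi)graph: vertices are 0 .. nV - 1, edges an explicit list of endpoint pairs.
record Graph : Set where
  constructor mkGraph
  field
    nV : ℕ
    E  : List (ℕ × ℕ)
open Graph public

pathEdges : (p len k : ℕ) → List (ℕ × ℕ)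
pathEdges p zero k = []
pathEdges p (suc zero) k = (p , 1) ∷ []
pathEdges p (suc (suc n)) k = (p , k) ∷ pathEdges k (suc n) (suc k)

bridgeEdges : List ℕ → ℕ → List (ℕ × ℕ)
bridgeEdges [] k = []
bridgeEdges (a ∷ as) k = pathEdges 0 a k ++ bridgeEdges as (k + (a ∸ 1))

-- The bridge graph θ(a₁,…,aₛ): u = 0, v = 1, internal vertices 2, 3, ...
θ : List ℕ → Graph
θ as = mkGraph (2 + sum (map (_∸ 1) as)) (bridgeEdges as 2)

-- A labeling: a bijection σ of the edge indices; edge e gets label σ(e)+1 ∈ {1,…,|E|}.
Labeling : Graph → Set
Labeling G = Σ (Fin (length (E G)) → Fin (length (E G))) (Bijective _≡_ _≡_)

label : (G : Graph) → Labeling G → Fin (length (E G)) → ℕ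
label G (σ , _) e = suc (toℕ (σ e))

incident : ℕ → ℕ × ℕ → Bool
incident x (a , b) = ⌊ x ≟ a ⌋ ∨ ⌊ x ≟ b ⌋

fplus : (G : Graph) → Labeling G → ℕ → ℕ
fplus G f x = sum (map (λ e → if incident x (lookup (E G) e) then label G f e else 0)
                       (allFin (length (E G))))

LocalAntimagic : (G : Graph) → Labeling G → Set
LocalAntimagic G f = ∀ e → ¬ (fplus G f (proj₁ (lookup (E G) e)) ≡ fplus G f (proj₂ (lookup (E G) e)))

colorNumber : (G : Graph) → Labeling G → ℕ
colorNumber G f = length (deduplicate _≟_ (map (fplus G f) (upTo (nV G))))

χla≡ : Graph → ℕ → Set
χla≡ G k = (Σ (Labeling G) λ f → LocalAntimagic G f × colorNumber G f ≡ k)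
         × (∀ (f : Labeling G) → LocalAntimagic G f → k ≤ colorNumber G f)

-- Write the labels of θ(2^[n], 4) as a word: the label pairs of the n paths of length 2, then the
-- labels e₁ … e₄ of the path of length 4, and let m = 2n + 4 be the number of edges.
-- If a local antimagic labelling had only two vertex sums, adjacency would force u and v and the
-- centre of the long path to share one value a and every other vertex to have value b. Each label
-- then has a partner summing to b, so b = m + 1, and adding the sums at u, v and the centre gives
-- 3a = (n + 2)(2n + 5). This fails for n = 1 (a = b), n = 3 (3 ∤ 55) and n ≥ 4 (a ≤ 2m is too
-- small), while n = 2 is excluded by a finite search. Three values are attained by explicit words
-- for n ≤ 4, and a word for n yields one for n + 4 by adding 4 to every label and prepending the
-- pairs {1, m+8}, {m+7, 2}, {m+6, 3}, {4, m+5}, which keeps all pair sums equal to the new b.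

module Submission where

open import Defs
open import Data.Nat using (ℕ; zero; suc; _+_; _*_; _∸_; _≤_; _<_; _≟_; _≤?_; _<?_; z≤n; s≤s)
open import Data.Nat.Properties
open import Data.Nat.DivMod using (_%_; m*n%n≡0)
open import Data.Nat.Tactic.RingSolver using (solve-∀)
open import Data.Fin as Fin using (Fin; toℕ; fromℕ<; punchOut)
open import Data.Fin.Properties
  using (toℕ<n; toℕ-fromℕ<; toℕ-injective; any?; punchOut-injective; injective⇒≤)
  renaming (_≟_ to _≟F_)
open import Data.List
  using (List; []; _∷_; _++_; length; map; upTo; lookup; replicate; tabulate; applyUpTo; deduplicate)
open import Data.List.Properties
  using ( map-tabulate; map-∘; map-cong; map-applyUpTo; tabulate-cong; tabulate-lookup
        ; length-map; length-tabulate; length-++; length-++-sucʳ; ++-identityʳ)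
open import Data.List.Relation.Unary.All as All using (All; []; _∷_)
open import Data.List.Relation.Unary.All.Properties using (++⁺; ++⁻; map⁺; map⁻; tabulate⁺)
import Data.List.Relation.Unary.Any as Any
open import Data.List.Relation.Unary.Any.Properties using (lookup-index)
open import Data.List.Membership.Propositional using (_∈_)
open import Data.List.Membership.DecPropositional _≟_ using (_∈?_)
open import Data.List.Membership.Propositional.Properties
  using (∈-lookup; ∈-tabulate⁺; ∈-applyUpTo⁺; ∈-map⁺; ∈-∃++; ∈-++⁻; ∈-++⁺ˡ; ∈-++⁺ʳ; ∈-deduplicate⁺; ∈-deduplicate⁻)
open import Data.List.Relation.Unary.Any using (here; there)
open import Data.List.Relation.Unary.Unique.Propositional using (Unique)
import Data.List.Relation.Unary.Unique.Propositional.Properties as Unique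
open import Data.List.Relation.Unary.AllPairs using ([]; _∷_)
open import Data.List.Relation.Unary.Unique.DecPropositional _≟_ using (unique?)
open import Data.List.Relation.Unary.Unique.DecPropositional.Properties _≟_ using (deduplicate-!)
open import Data.Product as Product using (_×_; _,_; proj₁; proj₂; Σ; ∃)
open import Data.Bool using (true; false; if_then_else_; _∨_)
open import Data.Bool.Properties using (∨-zeroʳ)
open import Relation.Nullary using (¬_; ¬?; Dec; yes; no; contradiction; _×-dec_)
open import Relation.Nullary.Decidable using (⌊_⌋; True; toWitness; isYes≗does; dec-true; dec-false; from-yes)
open import Relation.Binary.PropositionalEquality
open import Data.Nat.ListAction using (sum)
open import Data.Empty using (⊥; ⊥-elim)
open import Data.Sum as Sum using (_⊎_; inj₁; inj₂; [_,_]′)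
open import Function using (_∘_; id)
open import Function.Definitions using (Injective; Bijective)

applyUpTo-cong : ∀ {A : Set} {f g : ℕ → A} n → (∀ i → i < n → f i ≡ g i) → applyUpTo f n ≡ applyUpTo g n
applyUpTo-cong zero    f≗g = refl
applyUpTo-cong (suc n) f≗g = cong₂ _∷_ (f≗g 0 (s≤s z≤n)) (applyUpTo-cong n (λ i i<n → f≗g (suc i) (s≤s i<n)))

applyUpTo-++ : ∀ {A : Set} (f : ℕ → A) m k → applyUpTo f (m + k) ≡ applyUpTo f m ++ applyUpTo (λ i → f (i + m)) k
applyUpTo-++ f zero    k = applyUpTo-cong k (λ i _ → cong f (sym (+-identityʳ i)))
applyUpTo-++ f (suc m) k = cong (f 0 ∷_) (trans (applyUpTo-++ (f ∘ suc) m k)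
  (cong (applyUpTo (f ∘ suc) m ++_) (applyUpTo-cong k (λ i _ → cong f (sym (+-suc i m))))))

length-mono-⊆ : ∀ {xs ys : List ℕ} → Unique xs → All (_∈ ys) xs → length xs ≤ length ys
length-mono-⊆ []                  []              = z≤n
length-mono-⊆ {x ∷ xs} (x≢xs ∷ unique) (x∈ys ∷ xs⊆ys) with ∈-∃++ x∈ys
... | us , vs , refl = subst (suc (length xs) ≤_) (sym (length-++-sucʳ us x vs))
  (s≤s (length-mono-⊆ unique (All.zipWith (λ (x≢z , z∈) → ∈-remove (x≢z ∘ sym) z∈) (x≢xs , xs⊆ys))))
  where
  ∈-remove : ∀ {z} → z ≢ x → z ∈ us ++ x ∷ vs → z ∈ us ++ vs
  ∈-remove z≢x z∈ with ∈-++⁻ us z∈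
  ... | inj₁ z∈us          = ∈-++⁺ˡ z∈us
  ... | inj₂ (here z≡x)    = contradiction z≡x z≢x
  ... | inj₂ (there z∈vs)  = ∈-++⁺ʳ us z∈vs

3≤length-deduplicate : ∀ {x y z} xs → x ∈ xs → y ∈ xs → z ∈ xs → x ≢ y → x ≢ z → y ≢ z →
  3 ≤ length (deduplicate _≟_ xs)
3≤length-deduplicate xs x∈ y∈ z∈ x≢y x≢z y≢z = length-mono-⊆
  ((x≢y ∷ x≢z ∷ []) ∷ (y≢z ∷ []) ∷ [] ∷ [])
  (∈-deduplicate⁺ _≟_ x∈ ∷ ∈-deduplicate⁺ _≟_ y∈ ∷ ∈-deduplicate⁺ _≟_ z∈ ∷ [])

length-deduplicate≤ : ∀ xs ys → All (_∈ ys) xs → length (deduplicate _≟_ xs) ≤ length ys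
length-deduplicate≤ xs ys xs⊆ys =
  length-mono-⊆ (deduplicate-! xs) (All.tabulate (All.lookup xs⊆ys ∘ ∈-deduplicate⁻ _≟_ xs))

at-most-two-values : ∀ {a b w} xs → ¬ 3 ≤ length (deduplicate _≟_ xs) → a ∈ xs → b ∈ xs → a ≢ b →
  w ∈ xs → w ≡ a ⊎ w ≡ b
at-most-two-values {a} {b} {w} xs few a∈ b∈ a≢b w∈ with w ≟ a | w ≟ b
... | yes w≡a | _       = inj₁ w≡a
... | no  _   | yes w≡b = inj₂ w≡b
... | no  w≢a | no  w≢b = contradiction (3≤length-deduplicate xs a∈ b∈ w∈ a≢b (w≢a ∘ sym) (w≢b ∘ sym)) few

complement : ∀ u v {s} → u + v ≡ s → v ≡ s ∸ u
complement u v u+v≡s = trans (sym (m+n∸m≡n u v)) (cong (_∸ u) u+v≡s)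

sum-map-+ : ∀ k xs → sum (map (k +_) xs) ≡ length xs * k + sum xs
sum-map-+ k []       = refl
sum-map-+ k (x ∷ xs) = trans (cong (k + x +_) (sum-map-+ k xs)) (regroup k x (length xs) (sum xs))
  where
  regroup : ∀ k x l s → k + x + (l * k + s) ≡ suc l * k + (x + s)
  regroup = solve-∀

injective⇒surjective : ∀ {n} (g : Fin n → Fin n) → Injective _≡_ _≡_ g → ∀ y → ∃ λ x → g x ≡ y
injective⇒surjective {zero}  g injective ()
injective⇒surjective {suc n} g injective y with any? (λ x → g x ≟F y)
... | yes hit  = hit
... | no  miss = contradiction (injective⇒≤ squeeze-injective) 1+n≰n
  where
  y≢g : ∀ x → y ≢ g x
  y≢g x y≡gx = miss (x , sym y≡gx)
  squeeze : Fin (suc n) → Fin n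
  squeeze x = punchOut (y≢g x)
  squeeze-injective : Injective _≡_ _≡_ squeeze
  squeeze-injective = injective ∘ punchOut-injective (y≢g _) (y≢g _)

surjective⇒bijective : ∀ {n} (f : Fin n → Fin n) → (∀ y → ∃ λ x → f x ≡ y) → Bijective _≡_ _≡_ f
surjective⇒bijective {n} f surjective = injective , λ y → section y , λ { refl → proj₂ (surjective y) }
  where
  section : Fin n → Fin n
  section = proj₁ ∘ surjective
  section-injective : Injective _≡_ _≡_ section
  section-injective {x} {y} eq = trans (sym (proj₂ (surjective x))) (trans (cong f eq) (proj₂ (surjective y)))
  injective : Injective _≡_ _≡_ f
  injective {x} {y} fx≡fy
    with x′ , refl ← injective⇒surjective section section-injective x
       | y′ , refl ← injective⇒surjective section section-injective y
    = cong section (trans (sym (proj₂ (surjective x′))) (trans fx≡fy (proj₂ (surjective y′))))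

labelList : (G : Graph) → Labeling G → List ℕ
labelList G f = tabulate (label G f)

InRange : ℕ → List ℕ → Set
InRange m L = All (λ x → 1 ≤ x × x ≤ m) L

Covers : ℕ → List ℕ → Set
Covers m L = ∀ j → 1 ≤ j → j ≤ m → j ∈ L

labelList-inRange : ∀ G f → InRange (length (E G)) (labelList G f)
labelList-inRange G (σ , _) = tabulate⁺ (λ e → s≤s z≤n , toℕ<n (σ e))

labelList-covers : ∀ G f → Covers (length (E G)) (labelList G f)
labelList-covers G f@(σ , _ , surjective) (suc v) _ v<m with surjective (fromℕ< v<m)
... | e , σe≡v = subst (_∈ labelList G f)
  (cong suc (trans (cong toℕ (σe≡v refl)) (toℕ-fromℕ< v<m))) (∈-tabulate⁺ e)

labelList-unique : ∀ G f → Unique (labelList G f)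
labelList-unique G (σ , injective , _) = Unique.tabulate⁺ (injective ∘ toℕ-injective ∘ suc-injective)

permutationOf : ∀ {N} D → length D ≡ N → InRange N D → Covers N D →
  Σ (Fin N → Fin N) λ σ → Bijective _≡_ _≡_ σ × tabulate (λ i → suc (toℕ (σ i))) ≡ D
permutationOf D refl inRange covers = σ , surjective⇒bijective σ σ-surjective , σ-labels
  where
  N = length D
  label-suc : ∀ i → suc (lookup D i ∸ 1) ≡ lookup D i
  label-suc i = m+[n∸m]≡n (proj₁ (All.lookup inRange (∈-lookup i)))
  bound : ∀ i → lookup D i ∸ 1 < N
  bound i = subst (_≤ N) (sym (label-suc i)) (proj₂ (All.lookup inRange (∈-lookup i)))
  σ : Fin N → Fin N
  σ i = fromℕ< (bound i)
  σ-label : ∀ i → suc (toℕ (σ i)) ≡ lookup D i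
  σ-label i = trans (cong suc (toℕ-fromℕ< (bound i))) (label-suc i)
  σ-labels : tabulate (λ i → suc (toℕ (σ i))) ≡ D
  σ-labels = trans (tabulate-cong σ-label) (tabulate-lookup D)
  σ-surjective : ∀ y → ∃ λ i → σ i ≡ y
  σ-surjective y = Any.index y+1∈D ,
    toℕ-injective (suc-injective (trans (σ-label (Any.index y+1∈D)) (sym (lookup-index y+1∈D))))
    where
    y+1∈D : suc (toℕ y) ∈ D
    y+1∈D = covers (suc (toℕ y)) (s≤s z≤n) (toℕ<n y)

labelingOf : ∀ G D → length D ≡ length (E G) → InRange (length (E G)) D → Covers (length (E G)) D →
  Σ (Labeling G) λ F → labelList G F ≡ D
labelingOf G D eq inRange covers with σ , bijective , labels ← permutationOf D eq inRange covers =
  (σ , bijective) , labels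

inRange? : ∀ m L → Dec (InRange m L)
inRange? m = All.all? (λ x → 1 ≤? x ×-dec x ≤? m)

covers-from-all : ∀ {m L} → All (_∈ L) (applyUpTo suc m) → Covers m L
covers-from-all all∈ (suc i) _ i<m = All.lookup all∈ (∈-applyUpTo⁺ suc i<m)

incidenceSum : ℕ → List (ℕ × ℕ) → List ℕ → ℕ
incidenceSum x []         ls       = 0
incidenceSum x (_ ∷ _)    []       = 0
incidenceSum x (ed ∷ Es)  (l ∷ ls) = (if incident x ed then l else 0) + incidenceSum x Es ls

fplus≡incidenceSum : ∀ G f x → fplus G f x ≡ incidenceSum x (E G) (labelList G f)
fplus≡incidenceSum G f x =
  trans (cong sum (map-tabulate id term)) (sum-tabulate (E G) (label G f))
  where
  term : Fin (length (E G)) → ℕ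
  term e = if incident x (lookup (E G) e) then label G f e else 0
  sum-tabulate : ∀ Es (g : Fin (length Es) → ℕ) →
    sum (tabulate (λ e → if incident x (lookup Es e) then g e else 0)) ≡ incidenceSum x Es (tabulate g)
  sum-tabulate []        g = refl
  sum-tabulate (ed ∷ Es) g = cong ((if incident x ed then g Fin.zero else 0) +_) (sum-tabulate Es (g ∘ Fin.suc))

⌊⌋-yes : ∀ {A : Set} (a? : Dec A) → A → ⌊ a? ⌋ ≡ true
⌊⌋-yes a? a = trans (isYes≗does a?) (dec-true a? a)

⌊⌋-no : ∀ {A : Set} (a? : Dec A) → ¬ A → ⌊ a? ⌋ ≡ false
⌊⌋-no a? ¬a = trans (isYes≗does a?) (dec-false a? ¬a)

incident-fst : ∀ x b → incident x (x , b) ≡ true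
incident-fst x b = cong (_∨ ⌊ x ≟ b ⌋) (⌊⌋-yes (x ≟ x) refl)

incident-snd : ∀ x a → incident x (a , x) ≡ true
incident-snd x a = trans (cong (⌊ x ≟ a ⌋ ∨_) (⌊⌋-yes (x ≟ x) refl)) (∨-zeroʳ _)

incident-neither : ∀ {x a b} → x ≢ a → x ≢ b → incident x (a , b) ≡ false
incident-neither {x} {a} {b} x≢a x≢b = cong₂ _∨_ (⌊⌋-no (x ≟ a) x≢a) (⌊⌋-no (x ≟ b) x≢b)

if-hit : ∀ {b} l → b ≡ true → (if b then l else 0) ≡ l
if-hit l refl = refl

if-miss : ∀ {b} l → b ≡ false → (if b then l else 0) ≡ 0
if-miss l refl = refl

incidenceSum-away : ∀ x Es ls → All (λ ed → incident x ed ≡ false) Es → incidenceSum x Es ls ≡ 0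
incidenceSum-away x []        ls       []           = refl
incidenceSum-away x (ed ∷ Es) []       _            = refl
incidenceSum-away x (ed ∷ Es) (l ∷ ls) (miss ∷ away) =
  cong₂ _+_ (if-miss l miss) (incidenceSum-away x Es ls away)

incidenceSum-++ : ∀ x Es Es′ ls ls′ → length Es ≡ length ls →
  incidenceSum x (Es ++ Es′) (ls ++ ls′) ≡ incidenceSum x Es ls + incidenceSum x Es′ ls′
incidenceSum-++ x []        Es′ []       ls′ _  = refl
incidenceSum-++ x (ed ∷ Es) Es′ (l ∷ ls) ls′ eq =
  trans (cong ((if incident x ed then l else 0) +_) (incidenceSum-++ x Es Es′ ls ls′ (suc-injective eq)))
        (sym (+-assoc (if incident x ed then l else 0) _ _))

Proper : List (ℕ × ℕ) → (ℕ → ℕ) → Set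
Proper Es g = All (λ ed → g (proj₁ ed) ≢ g (proj₂ ed)) Es

Proper-cong : ∀ {g h} Es → (∀ x → g x ≡ h x) → Proper Es g → Proper Es h
Proper-cong Es g≗h = All.map (λ g≢ eq → g≢ (trans (g≗h _) (trans eq (sym (g≗h _)))))

localAntimagic⇒proper : ∀ G f → LocalAntimagic G f → Proper (E G) (fplus G f)
localAntimagic⇒proper G f la = All.tabulate λ ed∈ →
  subst (λ ed → fplus G f (proj₁ ed) ≢ fplus G f (proj₂ ed)) (sym (lookup-index ed∈)) (la (Any.index ed∈))

proper⇒localAntimagic : ∀ G f → Proper (E G) (fplus G f) → LocalAntimagic G f
proper⇒localAntimagic G f proper e = All.lookup proper (∈-lookup {xs = E G} e)

-- The bridge graph θ(2^[n], 4)

spokeEdges : ℕ → ℕ → List (ℕ × ℕ)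
spokeEdges zero    k = []
spokeEdges (suc n) k = (0 , k) ∷ (k , 1) ∷ spokeEdges n (suc k)

longPathEdges : ℕ → List (ℕ × ℕ)
longPathEdges k = (0 , k) ∷ (k , suc k) ∷ (suc k , suc (suc k)) ∷ (suc (suc k) , 1) ∷ []

Θ : ℕ → Graph
Θ n = θ (replicate n 2 ++ 4 ∷ [])

-- Vertex 0 is u, 1 is v, 2 … n + 1 are the middles of the paths of length 2, and p, q, r = 2 + n,
-- 3 + n, 4 + n are the internal vertices of the path of length 4.
Θ-edges : ℕ → List (ℕ × ℕ)
Θ-edges n = spokeEdges n 2 ++ longPathEdges (2 + n)

bridgeEdges-Θ : ∀ n k → bridgeEdges (replicate n 2 ++ 4 ∷ []) k ≡ spokeEdges n k ++ longPathEdges (k + n)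
bridgeEdges-Θ zero    k rewrite +-identityʳ k = ++-identityʳ _
bridgeEdges-Θ (suc n) k rewrite bridgeEdges-Θ n (k + 1) | +-comm k 1 | +-suc k n = refl

E-Θ : ∀ n → E (Θ n) ≡ Θ-edges n
E-Θ n = bridgeEdges-Θ n 2

nV-Θ : ∀ n → nV (Θ n) ≡ 2 + (n + 3)
nV-Θ n = cong (2 +_) (internalVertices n)
  where
  internalVertices : ∀ n → sum (map (_∸ 1) (replicate n 2 ++ 4 ∷ [])) ≡ n + 3
  internalVertices zero    = refl
  internalVertices (suc n) = cong suc (internalVertices n)

length-spokeEdges : ∀ n k → length (spokeEdges n k) ≡ n + n
length-spokeEdges zero    k = refl
length-spokeEdges (suc n) k = cong suc (trans (cong suc (length-spokeEdges n (suc k))) (sym (+-suc n n)))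

edgeCount : ℕ → ℕ
edgeCount n = n + n + 4

edgeCount-Θ : ∀ n → length (E (Θ n)) ≡ edgeCount n
edgeCount-Θ n = trans (cong length (E-Θ n)) (trans (length-++ (spokeEdges n 2)) (cong (_+ 4) (length-spokeEdges n 2)))

spokeEdges-away : ∀ {x} n k → 2 ≤ x → x < k ⊎ k + n ≤ x →
  All (λ ed → incident x ed ≡ false) (spokeEdges n k)
spokeEdges-away zero    k _ _ = []
spokeEdges-away {x} (suc n) k 2≤x outside =
  incident-neither x≢0 x≢k ∷ incident-neither x≢k (>⇒≢ 2≤x) ∷ spokeEdges-away n (suc k) 2≤x outside′
  where
  x≢0 : x ≢ 0
  x≢0 = >⇒≢ (≤-trans (s≤s z≤n) 2≤x)
  x≢k : x ≢ k
  x≢k = [ <⇒≢ , (λ k+n<x → >⇒≢ (≤-trans (s≤s (m≤m+n k n)) (subst (_≤ x) (+-suc k n) k+n<x))) ]′ outside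
  outside′ : x < suc k ⊎ suc k + n ≤ x
  outside′ = Sum.map m<n⇒m<1+n (subst (_≤ x) (+-suc k n)) outside

longPathEdges-away : ∀ {x} k → 2 ≤ x → x < k → All (λ ed → incident x ed ≡ false) (longPathEdges k)
longPathEdges-away {x} k 2≤x x<k =
  incident-neither (>⇒≢ (≤-trans (s≤s z≤n) 2≤x)) (<⇒≢ x<k) ∷
  incident-neither (<⇒≢ x<k) (<⇒≢ x<1+k) ∷
  incident-neither (<⇒≢ x<1+k) (<⇒≢ (m<n⇒m<1+n x<1+k)) ∷
  incident-neither (<⇒≢ (m<n⇒m<1+n x<1+k)) (>⇒≢ 2≤x) ∷ []
  where
  x<1+k : x < suc k
  x<1+k = m<n⇒m<1+n x<k

-- In a label word, ps lists the label pairs of the paths of length 2 and e₁ … e₄ label the path of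
-- length 4 from u to v.
unpair : List (ℕ × ℕ) → List ℕ
unpair []             = []
unpair ((a , b) ∷ ps) = a ∷ b ∷ unpair ps

labelWord : List (ℕ × ℕ) → ℕ → ℕ → ℕ → ℕ → List ℕ
labelWord ps e₁ e₂ e₃ e₄ = unpair ps ++ e₁ ∷ e₂ ∷ e₃ ∷ e₄ ∷ []

pairSums : List (ℕ × ℕ) → List ℕ
pairSums = map (λ p → proj₁ p + proj₂ p)

hubSum₀ : List (ℕ × ℕ) → ℕ → ℕ
hubSum₀ ps e₁ = sum (map proj₁ ps) + e₁

hubSum₁ : List (ℕ × ℕ) → ℕ → ℕ
hubSum₁ ps e₄ = sum (map proj₂ ps) + e₄

vertexSums : List (ℕ × ℕ) → ℕ → ℕ → ℕ → ℕ → List ℕ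
vertexSums ps e₁ e₂ e₃ e₄ =
  hubSum₀ ps e₁ ∷ hubSum₁ ps e₄ ∷ pairSums ps ++ (e₁ + e₂) ∷ (e₂ + e₃) ∷ (e₃ + e₄) ∷ []

length-unpair : ∀ ps → length (unpair ps) ≡ length ps + length ps
length-unpair []             = refl
length-unpair ((a , b) ∷ ps) = cong suc (trans (cong suc (length-unpair ps)) (sym (+-suc _ _)))

spokeSums₀ : ∀ ps j → incidenceSum 0 (spokeEdges (length ps) (2 + j)) (unpair ps) ≡ sum (map proj₁ ps)
spokeSums₀ []             j = refl
spokeSums₀ ((a , b) ∷ ps) j = cong (a +_) (spokeSums₀ ps (suc j))

spokeSums₁ : ∀ ps j → incidenceSum 1 (spokeEdges (length ps) (2 + j)) (unpair ps) ≡ sum (map proj₂ ps)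
spokeSums₁ []             j = refl
spokeSums₁ ((a , b) ∷ ps) j = cong (b +_) (spokeSums₁ ps (suc j))

spokeSums : ∀ ps k → 2 ≤ k →
  applyUpTo (λ i → incidenceSum (k + i) (spokeEdges (length ps) k) (unpair ps)) (length ps) ≡ pairSums ps
spokeSums []             k 2≤k = refl
spokeSums ((a , b) ∷ ps) k 2≤k = cong₂ _∷_ middle others
  where
  n = length ps
  middle : incidenceSum (k + 0) (spokeEdges (suc n) k) (a ∷ b ∷ unpair ps) ≡ a + b
  middle rewrite +-identityʳ k = trans
    (cong₂ _+_ (if-hit a (incident-snd k 0)) (cong₂ _+_ (if-hit b (incident-fst k 1))
      (incidenceSum-away k _ _ (spokeEdges-away n (suc k) 2≤k (inj₁ (n<1+n k))))))
    (cong (a +_) (+-identityʳ b))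
  shifted : ∀ i → incidenceSum (k + suc i) (spokeEdges (suc n) k) (a ∷ b ∷ unpair ps)
                ≡ incidenceSum (suc k + i) (spokeEdges n (suc k)) (unpair ps)
  shifted i rewrite +-suc k i =
    cong₂ _+_ (if-miss a (incident-neither {a = 0} (λ ()) k+i≢k))
              (cong₂ _+_ (if-miss b (incident-neither k+i≢k (>⇒≢ (s≤s (≤-trans (≤-trans (s≤s z≤n) 2≤k) (m≤m+n k i))))))
                         refl)
    where
    k+i≢k : suc (k + i) ≢ k
    k+i≢k = >⇒≢ (s≤s (m≤m+n k i))
  others = trans (applyUpTo-cong n (λ i _ → shifted i)) (spokeSums ps (suc k) (≤-trans 2≤k (n≤1+n k)))

module LongPathSums (j e₁ e₂ e₃ e₄ : ℕ) where
  private
    k : ℕ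
    k = 2 + j
    P : List ℕ
    P = e₁ ∷ e₂ ∷ e₃ ∷ e₄ ∷ []
    k<2+k : k < suc (suc k)
    k<2+k = m<n⇒m<1+n (n<1+n k)

  at-p : incidenceSum k (longPathEdges k) P ≡ e₁ + e₂
  at-p = trans
    (cong₂ _+_ (if-hit e₁ (incident-snd k 0)) (cong₂ _+_ (if-hit e₂ (incident-fst k (suc k)))
      (cong₂ _+_ (if-miss e₃ (incident-neither (<⇒≢ (n<1+n k)) (<⇒≢ k<2+k)))
        (cong₂ _+_ (if-miss e₄ (incident-neither {b = 1} (<⇒≢ k<2+k) (λ ()))) refl))))
    (cong (e₁ +_) (+-identityʳ e₂))

  at-q : incidenceSum (suc k) (longPathEdges k) P ≡ e₂ + e₃
  at-q = trans
    (cong₂ _+_ (if-miss e₁ (incident-neither {a = 0} (λ ()) (>⇒≢ (n<1+n k))))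
      (cong₂ _+_ (if-hit e₂ (incident-snd (suc k) k))
      (cong₂ _+_ (if-hit e₃ (incident-fst (suc k) (suc (suc k))))
        (cong₂ _+_ (if-miss e₄ (incident-neither {b = 1} (<⇒≢ (n<1+n (suc k))) (λ ()))) refl))))
    (cong (e₂ +_) (+-identityʳ e₃))

  at-r : incidenceSum (suc (suc k)) (longPathEdges k) P ≡ e₃ + e₄
  at-r = trans
    (cong₂ _+_ (if-miss e₁ (incident-neither {a = 0} (λ ()) (>⇒≢ k<2+k)))
      (cong₂ _+_ (if-miss e₂ (incident-neither (>⇒≢ k<2+k) (>⇒≢ (n<1+n (suc k)))))
        (cong₂ _+_ (if-hit e₃ (incident-snd (suc (suc k)) (suc k)))
          (cong₂ _+_ (if-hit e₄ (incident-fst (suc (suc k)) 1)) refl))))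
    (cong (e₃ +_) (+-identityʳ e₄))

wordSum : List (ℕ × ℕ) → ℕ → ℕ → ℕ → ℕ → ℕ → ℕ
wordSum ps e₁ e₂ e₃ e₄ x = incidenceSum x (Θ-edges (length ps)) (labelWord ps e₁ e₂ e₃ e₄)

module WordSums (ps : List (ℕ × ℕ)) (e₁ e₂ e₃ e₄ : ℕ) where
  private
    n : ℕ
    n = length ps
    g : ℕ → ℕ
    g = wordSum ps e₁ e₂ e₃ e₄
    P : List ℕ
    P = e₁ ∷ e₂ ∷ e₃ ∷ e₄ ∷ []
    split : ∀ x → g x ≡ incidenceSum x (spokeEdges n 2) (unpair ps) + incidenceSum x (longPathEdges (2 + n)) P
    split x = incidenceSum-++ x (spokeEdges n 2) _ (unpair ps) P
                (trans (length-spokeEdges n 2) (sym (length-unpair ps)))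
    beyond-spokes : ∀ x → 2 + n ≤ x → g x ≡ incidenceSum x (longPathEdges (2 + n)) P
    beyond-spokes x 2+n≤x = trans (split x) (cong (_+ incidenceSum x (longPathEdges (2 + n)) P)
      (incidenceSum-away x _ _ (spokeEdges-away n 2 (≤-trans (s≤s (s≤s z≤n)) 2+n≤x) (inj₂ 2+n≤x))))

  at-hub₀ : g 0 ≡ hubSum₀ ps e₁
  at-hub₀ = trans (split 0) (cong₂ _+_ (spokeSums₀ ps 0) (+-identityʳ e₁))

  at-hub₁ : g 1 ≡ hubSum₁ ps e₄
  at-hub₁ = trans (split 1) (cong₂ _+_ (spokeSums₁ ps 0) (+-identityʳ e₄))

  at-spokes : applyUpTo (λ i → g (2 + i)) n ≡ pairSums ps
  at-spokes = trans (applyUpTo-cong n on-spoke) (spokeSums ps 2 (s≤s (s≤s z≤n)))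
    where
    on-spoke : ∀ i → i < n → g (2 + i) ≡ incidenceSum (2 + i) (spokeEdges n 2) (unpair ps)
    on-spoke i i<n = trans (split (2 + i)) (trans (cong (incidenceSum (2 + i) (spokeEdges n 2) (unpair ps) +_)
      (incidenceSum-away (2 + i) _ P (longPathEdges-away (2 + n) (s≤s (s≤s z≤n)) (s≤s (s≤s i<n)))))
      (+-identityʳ _))

  at-p : g (2 + n) ≡ e₁ + e₂
  at-p = trans (beyond-spokes (2 + n) ≤-refl) (LongPathSums.at-p n e₁ e₂ e₃ e₄)

  at-q : g (3 + n) ≡ e₂ + e₃
  at-q = trans (beyond-spokes (3 + n) (n≤1+n _)) (LongPathSums.at-q n e₁ e₂ e₃ e₄)

  at-r : g (4 + n) ≡ e₃ + e₄
  at-r = trans (beyond-spokes (4 + n) (m≤n⇒m≤1+n (n≤1+n _))) (LongPathSums.at-r n e₁ e₂ e₃ e₄)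

  at-all : applyUpTo g (2 + (n + 3)) ≡ vertexSums ps e₁ e₂ e₃ e₄
  at-all = cong₂ _∷_ at-hub₀ (cong₂ _∷_ at-hub₁ (trans (applyUpTo-++ (λ i → g (2 + i)) n 3)
    (cong₂ _++_ at-spokes (cong₂ _∷_ at-p (cong₂ _∷_ at-q (cong₂ _∷_ at-r refl))))))

Proper-spokeEdges⁻ : ∀ g n k → Proper (spokeEdges n k) g →
  All (λ s → g 0 ≢ s × s ≢ g 1) (applyUpTo (λ i → g (k + i)) n)
Proper-spokeEdges⁻ g zero    k []                 = []
Proper-spokeEdges⁻ g (suc n) k (g₀≢ ∷ ≢g₁ ∷ rest) =
  (subst (λ x → g 0 ≢ g x) (sym (+-identityʳ k)) g₀≢ , subst (λ x → g x ≢ g 1) (sym (+-identityʳ k)) ≢g₁) ∷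
  subst (All _) (applyUpTo-cong n (λ i _ → cong g (sym (+-suc k i)))) (Proper-spokeEdges⁻ g n (suc k) rest)

Proper-spokeEdges⁺ : ∀ g n k → All (λ s → g 0 ≢ s × s ≢ g 1) (applyUpTo (λ i → g (k + i)) n) →
  Proper (spokeEdges n k) g
Proper-spokeEdges⁺ g zero    k []                   = []
Proper-spokeEdges⁺ g (suc n) k ((g₀≢ , ≢g₁) ∷ rest) =
  subst (λ x → g 0 ≢ g x) (+-identityʳ k) g₀≢ ∷ subst (λ x → g x ≢ g 1) (+-identityʳ k) ≢g₁ ∷
  Proper-spokeEdges⁺ g n (suc k) (subst (All _) (applyUpTo-cong n (λ i _ → cong g (+-suc k i))) rest)

ProperSums : List (ℕ × ℕ) → ℕ → ℕ → ℕ → ℕ → Set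
ProperSums ps e₁ e₂ e₃ e₄ =
  All (λ s → hubSum₀ ps e₁ ≢ s × s ≢ hubSum₁ ps e₄) (pairSums ps) ×
  hubSum₀ ps e₁ ≢ e₁ + e₂ × e₁ + e₂ ≢ e₂ + e₃ × e₂ + e₃ ≢ e₃ + e₄ × e₃ + e₄ ≢ hubSum₁ ps e₄

module _ (ps : List (ℕ × ℕ)) (e₁ e₂ e₃ e₄ : ℕ) where
  open WordSums ps e₁ e₂ e₃ e₄
  private
    n : ℕ
    n = length ps
    g : ℕ → ℕ
    g = wordSum ps e₁ e₂ e₃ e₄

  proper⇒properSums : Proper (Θ-edges n) g → ProperSums ps e₁ e₂ e₃ e₄
  proper⇒properSums proper with ++⁻ (spokeEdges n 2) proper
  ... | spokes , (p₀ ∷ p₁ ∷ p₂ ∷ p₃ ∷ []) =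
    subst (All _) at-spokes (All.map (Product.map (subst (λ h → h ≢ _) at-hub₀) (subst (λ h → _ ≢ h) at-hub₁))
                                     (Proper-spokeEdges⁻ g n 2 spokes)) ,
    subst₂ _≢_ at-hub₀ at-p p₀ , subst₂ _≢_ at-p at-q p₁ , subst₂ _≢_ at-q at-r p₂ , subst₂ _≢_ at-r at-hub₁ p₃

  properSums⇒proper : ProperSums ps e₁ e₂ e₃ e₄ → Proper (Θ-edges n) g
  properSums⇒proper (spokes , p₀ , p₁ , p₂ , p₃) =
    ++⁺ (Proper-spokeEdges⁺ g n 2 (subst (All _) (sym at-spokes)
          (All.map (Product.map (subst (λ h → h ≢ _) (sym at-hub₀)) (subst (λ h → _ ≢ h) (sym at-hub₁))) spokes)))
        (subst₂ _≢_ (sym at-hub₀) (sym at-p) p₀ ∷ subst₂ _≢_ (sym at-p) (sym at-q) p₁ ∷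
         subst₂ _≢_ (sym at-q) (sym at-r) p₂ ∷ subst₂ _≢_ (sym at-r) (sym at-hub₁) p₃ ∷ [])

module _ {ps : List (ℕ × ℕ)} {e₁ e₂ e₃ e₄ : ℕ} (F : Labeling (Θ (length ps)))
         (word : labelList (Θ (length ps)) F ≡ labelWord ps e₁ e₂ e₃ e₄) where
  private
    n : ℕ
    n = length ps

  fplus-Θ : ∀ x → fplus (Θ n) F x ≡ wordSum ps e₁ e₂ e₃ e₄ x
  fplus-Θ x = trans (fplus≡incidenceSum (Θ n) F x) (cong₂ (incidenceSum x) (E-Θ n) word)

  localAntimagic⇒properSums : LocalAntimagic (Θ n) F → ProperSums ps e₁ e₂ e₃ e₄
  localAntimagic⇒properSums la = proper⇒properSums ps e₁ e₂ e₃ e₄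
    (Proper-cong (Θ-edges n) fplus-Θ
      (subst (λ Es → Proper Es (fplus (Θ n) F)) (E-Θ n) (localAntimagic⇒proper (Θ n) F la)))

  properSums⇒localAntimagic : ProperSums ps e₁ e₂ e₃ e₄ → LocalAntimagic (Θ n) F
  properSums⇒localAntimagic proper = proper⇒localAntimagic (Θ n) F
    (subst (λ Es → Proper Es (fplus (Θ n) F)) (sym (E-Θ n))
      (Proper-cong (Θ-edges n) (sym ∘ fplus-Θ) (properSums⇒proper ps e₁ e₂ e₃ e₄ proper)))

  colorNumber-Θ : colorNumber (Θ n) F ≡ length (deduplicate _≟_ (vertexSums ps e₁ e₂ e₃ e₄))
  colorNumber-Θ = cong (length ∘ deduplicate _≟_) (begin
    map (fplus (Θ n) F) (upTo (nV (Θ n)))           ≡⟨ cong (map (fplus (Θ n) F) ∘ upTo) (nV-Θ n) ⟩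
    map (fplus (Θ n) F) (upTo (2 + (n + 3)))         ≡⟨ map-applyUpTo id (fplus (Θ n) F) _ ⟩
    applyUpTo (fplus (Θ n) F) (2 + (n + 3))          ≡⟨ applyUpTo-cong _ (λ x _ → fplus-Θ x) ⟩
    applyUpTo (wordSum ps e₁ e₂ e₃ e₄) (2 + (n + 3)) ≡⟨ WordSums.at-all ps e₁ e₂ e₃ e₄ ⟩
    vertexSums ps e₁ e₂ e₃ e₄                        ∎)
    where open ≡-Reasoning

length-labelWord : ∀ ps e₁ e₂ e₃ e₄ → length (labelWord ps e₁ e₂ e₃ e₄) ≡ edgeCount (length ps)
length-labelWord ps e₁ e₂ e₃ e₄ = trans (length-++ (unpair ps)) (cong (_+ 4) (length-unpair ps))

-- u and v get the sum a, the middle vertices of the paths of length 2 and the two outer internal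
-- vertices of the path of length 4 get b, and its central vertex gets c.
record SumPattern (ps : List (ℕ × ℕ)) (e₁ e₂ e₃ e₄ a b c : ℕ) : Set where
  field
    spokes : All (λ p → proj₁ p + proj₂ p ≡ b) ps
    left   : e₁ + e₂ ≡ b
    right  : e₃ + e₄ ≡ b
    middle : e₂ + e₃ ≡ c
    hub₀   : hubSum₀ ps e₁ ≡ a
    hub₁   : hubSum₁ ps e₄ ≡ a

sum-fst+sum-snd : ∀ {b} ps → All (λ p → proj₁ p + proj₂ p ≡ b) ps →
  sum (map proj₁ ps) + sum (map proj₂ ps) ≡ length ps * b
sum-fst+sum-snd []             []             = refl
sum-fst+sum-snd ((x , y) ∷ ps) (x+y≡b ∷ rest) =
  trans (interchange x y _ _) (cong₂ _+_ x+y≡b (sum-fst+sum-snd ps rest))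
  where
  interchange : ∀ x y u v → (x + u) + (y + v) ≡ (x + y) + (u + v)
  interchange = solve-∀

unpair-partner : ∀ {b z} ps → All (λ p → proj₁ p + proj₂ p ≡ b) ps → z ∈ unpair ps →
  ∃ λ w → w ∈ unpair ps × z + w ≡ b
unpair-partner ((x , y) ∷ ps) (x+y≡b ∷ _) (here refl)         = y , there (here refl) , x+y≡b
unpair-partner ((x , y) ∷ ps) (x+y≡b ∷ _) (there (here refl)) = x , here refl , trans (+-comm y x) x+y≡b
unpair-partner ((x , y) ∷ ps) (_ ∷ rest)  (there (there z∈))
  with w , w∈ , z+w≡b ← unpair-partner ps rest z∈ = w , there (there w∈) , z+w≡b

pairing⇒sum : ∀ {m b L} → 1 ≤ m → InRange m L → Covers m L →
  (∀ {z} → z ∈ L → ∃ λ w → w ∈ L × z + w ≡ b) → b ≡ suc m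
pairing⇒sum {m} {b} 1≤m inRange covers partner = ≤-antisym b≤1+m 1+m≤b
  where
  b≤1+m : b ≤ suc m
  b≤1+m with w , w∈ , 1+w≡b ← partner (covers 1 ≤-refl 1≤m) =
    subst (_≤ suc m) 1+w≡b (s≤s (proj₂ (All.lookup inRange w∈)))
  1+m≤b : suc m ≤ b
  1+m≤b with w , w∈ , m+w≡b ← partner (covers m 1≤m ≤-refl) =
    subst (suc m ≤_) (trans (+-comm w m) m+w≡b) (+-monoˡ-≤ m (proj₁ (All.lookup inRange w∈)))

module _ {ps : List (ℕ × ℕ)} {e₁ e₂ e₃ e₄ a b c : ℕ} (shape : SumPattern ps e₁ e₂ e₃ e₄ a b c) where
  open SumPattern shape

  hubs+middle : a + a + c ≡ (length ps + 2) * b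
  hubs+middle = begin
    a + a + c                          ≡⟨ cong₂ _+_ (cong₂ _+_ (sym hub₀) (sym hub₁)) (sym middle) ⟩
    (S₁ + e₁) + (S₂ + e₄) + (e₂ + e₃)  ≡⟨ regroup S₁ S₂ e₁ e₂ e₃ e₄ ⟩
    (S₁ + S₂) + (e₁ + e₂) + (e₃ + e₄)  ≡⟨ cong₂ _+_ (cong₂ _+_ (sum-fst+sum-snd ps spokes) left) right ⟩
    length ps * b + b + b              ≡⟨ count (length ps) b ⟩
    (length ps + 2) * b                ∎
    where
    open ≡-Reasoning
    S₁ = sum (map proj₁ ps)
    S₂ = sum (map proj₂ ps)
    regroup : ∀ S₁ S₂ e₁ e₂ e₃ e₄ → (S₁ + e₁) + (S₂ + e₄) + (e₂ + e₃) ≡ (S₁ + S₂) + (e₁ + e₂) + (e₃ + e₄)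
    regroup = solve-∀
    count : ∀ n b → n * b + b + b ≡ (n + 2) * b
    count = solve-∀

  labelWord-pairing : ∀ {z} → z ∈ labelWord ps e₁ e₂ e₃ e₄ → ∃ λ w → w ∈ labelWord ps e₁ e₂ e₃ e₄ × z + w ≡ b
  labelWord-pairing z∈ with ∈-++⁻ (unpair ps) z∈
  ... | inj₁ z∈ps with w , w∈ , z+w≡b ← unpair-partner ps spokes z∈ps = w , ∈-++⁺ˡ w∈ , z+w≡b
  ... | inj₂ (here refl)                         = e₂ , ∈-++⁺ʳ (unpair ps) (there (here refl)) , left
  ... | inj₂ (there (here refl))                 = e₁ , ∈-++⁺ʳ (unpair ps) (here refl) , trans (+-comm e₂ e₁) left
  ... | inj₂ (there (there (here refl)))         = e₄ , ∈-++⁺ʳ (unpair ps) (there (there (there (here refl)))) , right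
  ... | inj₂ (there (there (there (here refl)))) =
    e₃ , ∈-++⁺ʳ (unpair ps) (there (there (here refl))) , trans (+-comm e₄ e₃) right

  vertexSums-values : All (_∈ a ∷ b ∷ c ∷ []) (vertexSums ps e₁ e₂ e₃ e₄)
  vertexSums-values = here hub₀ ∷ here hub₁ ∷
    ++⁺ (map⁺ (All.map (there ∘ here) spokes))
        (there (here left) ∷ there (there (here middle)) ∷ there (here right) ∷ [])

  shape⇒properSums : a ≢ b → b ≢ c → ProperSums ps e₁ e₂ e₃ e₄
  shape⇒properSums a≢b b≢c =
    map⁺ (All.map (λ s≡b → (λ h≡s → a≢b (trans (sym hub₀) (trans h≡s s≡b))) ,
                           (λ s≡h → a≢b (trans (sym hub₁) (trans (sym s≡h) s≡b)))) spokes) ,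
    (λ eq → a≢b (trans (sym hub₀) (trans eq left))) ,
    (λ eq → b≢c (trans (sym left) (trans eq middle))) ,
    (λ eq → b≢c (trans (sym right) (trans (sym eq) middle))) ,
    (λ eq → a≢b (trans (sym hub₁) (trans (sym eq) right)))

-- Two vertex sums are not enough

module _ (x y : ℕ) (ps : List (ℕ × ℕ)) (e₁ e₂ e₃ e₄ : ℕ) where
  private
    qs : List (ℕ × ℕ)
    qs = (x , y) ∷ ps
    a : ℕ
    a = hubSum₀ qs e₁
    V : List ℕ
    V = vertexSums qs e₁ e₂ e₃ e₄

  twoValues⇒sumPattern : ProperSums qs e₁ e₂ e₃ e₄ → ¬ 3 ≤ length (deduplicate _≟_ V) →
    a ≢ x + y × SumPattern qs e₁ e₂ e₃ e₄ a (x + y) a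
  twoValues⇒sumPattern (spokes , a≢p , p≢q , _ , r≢hub₁) few = a≢b , record
    { spokes = map⁻ (All.tabulate λ s∈ → not-a (there (there (∈-++⁺ˡ s∈))) (proj₁ (All.lookup spokes s∈) ∘ sym))
    ; left   = left
    ; right  = not-a (onPath (there (there (here refl)))) (λ r≡a → r≢hub₁ (trans r≡a (sym hub₁)))
    ; middle = not-b (onPath (there (here refl))) (λ q≡b → p≢q (trans left (sym q≡b)))
    ; hub₀   = refl
    ; hub₁   = hub₁
    }
    where
    a≢b : a ≢ x + y
    a≢b = proj₁ (All.head spokes)
    colour : ∀ {w} → w ∈ V → w ≡ a ⊎ w ≡ x + y
    colour = at-most-two-values V few (here refl) (there (there (here refl))) a≢b
    not-a : ∀ {w} → w ∈ V → w ≢ a → w ≡ x + y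
    not-a w∈ w≢a = [ (λ w≡a → contradiction w≡a w≢a) , id ]′ (colour w∈)
    not-b : ∀ {w} → w ∈ V → w ≢ x + y → w ≡ a
    not-b w∈ w≢b = [ id , (λ w≡b → contradiction w≡b w≢b) ]′ (colour w∈)
    onPath : ∀ {w} → w ∈ (e₁ + e₂) ∷ (e₂ + e₃) ∷ (e₃ + e₄) ∷ [] → w ∈ V
    onPath w∈ = there (there (∈-++⁺ʳ (pairSums qs) w∈))
    hub₁ : hubSum₁ qs e₄ ≡ a
    hub₁ = not-b (there (here refl)) (proj₂ (All.head spokes) ∘ sym)
    left : e₁ + e₂ ≡ x + y
    left = not-a (onPath (here refl)) (a≢p ∘ sym)

-- For n = 2 we get b = 9 and a = 12, and the whole label word is then determined by x₀ and e₁.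
eightLabels : ℕ → ℕ → List ℕ
eightLabels x₀ e₁ = x₀ ∷ 9 ∸ x₀ ∷ x₂ ∷ 9 ∸ x₂ ∷ e₁ ∷ 9 ∸ e₁ ∷ e₃ ∷ 9 ∸ e₃ ∷ []
  where
  x₂ = 12 ∸ (x₀ + e₁)
  e₃ = 12 ∸ (9 ∸ e₁)

eightLabels-impossible : ∀ {x₀} → x₀ < 9 → ∀ {e₁} → e₁ < 9 →
  ¬ (InRange 8 (eightLabels x₀ e₁) × Unique (eightLabels x₀ e₁))
eightLabels-impossible = from-yes
  (allUpTo? (λ x₀ → allUpTo? (λ e₁ → ¬? (inRange? 8 (eightLabels x₀ e₁) ×-dec unique? (eightLabels x₀ e₁))) 9) 9)

private
  hub-regroup : ∀ x₀ x₂ e₁ → (x₀ + e₁) + x₂ ≡ (x₀ + (x₂ + 0)) + e₁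
  hub-regroup = solve-∀

twoSpokes-word : ∀ {x₀ x₁ x₂ x₃ e₁ e₂ e₃ e₄} → SumPattern ((x₀ , x₁) ∷ (x₂ , x₃) ∷ []) e₁ e₂ e₃ e₄ 12 9 12 →
  labelWord ((x₀ , x₁) ∷ (x₂ , x₃) ∷ []) e₁ e₂ e₃ e₄ ≡ eightLabels x₀ e₁
twoSpokes-word {x₀} {x₁} {x₂} {x₃} {e₁} {e₂} {e₃} {e₄}
  record { spokes = x₀+x₁≡9 ∷ x₂+x₃≡9 ∷ [] ; left = left ; right = right ; middle = middle ; hub₀ = hub₀ }
  with refl ← complement x₀ x₁ x₀+x₁≡9 | refl ← complement (x₀ + e₁) x₂ (trans (hub-regroup x₀ x₂ e₁) hub₀)
     | refl ← complement x₂ x₃ x₂+x₃≡9 | refl ← complement e₁ e₂ left | refl ← complement e₂ e₃ middle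
     | refl ← complement e₃ e₄ right
  = refl

module TwoValued {ps : List (ℕ × ℕ)} {e₁ e₂ e₃ e₄ a b : ℕ} (shape : SumPattern ps e₁ e₂ e₃ e₄ a b a)
         (inRange : InRange (edgeCount (length ps)) (labelWord ps e₁ e₂ e₃ e₄))
         (covers : Covers (edgeCount (length ps)) (labelWord ps e₁ e₂ e₃ e₄)) where

  b≡1+edgeCount : b ≡ suc (edgeCount (length ps))
  b≡1+edgeCount = pairing⇒sum (≤-trans (s≤s z≤n) (m≤n+m 4 _)) inRange covers (labelWord-pairing shape)

  3a≡[n+2]b : 3 * a ≡ (length ps + 2) * suc (edgeCount (length ps))
  3a≡[n+2]b = trans (triple a) (trans (hubs+middle shape) (cong ((length ps + 2) *_) b≡1+edgeCount))
    where
    triple : ∀ a → 3 * a ≡ a + a + a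
    triple = solve-∀

  a≤m+m : a ≤ edgeCount (length ps) + edgeCount (length ps)
  a≤m+m = subst (_≤ _) (SumPattern.middle shape)
    (+-mono-≤ (bound (there (here refl))) (bound (there (there (here refl)))))
    where
    bound : ∀ {z} → z ∈ e₁ ∷ e₂ ∷ e₃ ∷ e₄ ∷ [] → z ≤ edgeCount (length ps)
    bound z∈ = proj₂ (All.lookup inRange (∈-++⁺ʳ (unpair ps) z∈))

twoValued-impossible : ∀ ps {e₁ e₂ e₃ e₄ a b} → 1 ≤ length ps → a ≢ b → SumPattern ps e₁ e₂ e₃ e₄ a b a →
  InRange (edgeCount (length ps)) (labelWord ps e₁ e₂ e₃ e₄) →
  Covers (edgeCount (length ps)) (labelWord ps e₁ e₂ e₃ e₄) → Unique (labelWord ps e₁ e₂ e₃ e₄) → ⊥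
twoValued-impossible (_ ∷ []) {a = a} {b} _ a≢b shape inRange covers _ =
  a≢b (*-cancelˡ-≡ a b 3 (trans 3a≡[n+2]b (cong (3 *_) (sym b≡1+edgeCount))))
  where open TwoValued shape inRange covers
twoValued-impossible ((x₀ , _) ∷ _ ∷ []) {a = a} _ _ shape inRange covers unique
  with refl ← TwoValued.b≡1+edgeCount shape inRange covers
  with refl ← *-cancelˡ-≡ a 12 3 (TwoValued.3a≡[n+2]b shape inRange covers)
  = eightLabels-impossible (s≤s (proj₂ (All.lookup inRange (here refl))))
      (s≤s (proj₂ (All.lookup inRange (there (there (there (there (here refl))))))))
      (subst (InRange 8) (twoSpokes-word shape) inRange , subst Unique (twoSpokes-word shape) unique)
twoValued-impossible (_ ∷ _ ∷ _ ∷ []) {a = a} _ _ shape inRange covers _ =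
  contradiction (trans (sym (m*n%n≡0 a 3)) (cong (_% 3) (trans (*-comm a 3) 3a≡[n+2]b))) λ ()
  where open TwoValued shape inRange covers
twoValued-impossible ps@(_ ∷ _ ∷ _ ∷ _ ∷ rest) {a = a} _ _ shape inRange covers _ =
  <-irrefl 3a≡[n+2]b (begin-strict
    3 * a                              ≤⟨ *-monoʳ-≤ 3 a≤m+m ⟩
    3 * (m + m)                        <⟨ m<m+n (3 * (m + m)) (s≤s z≤n) ⟩
    3 * (m + m) + suc (5 + 13 * k + 2 * (k * k)) ≡⟨ sym (growth k) ⟩
    (length ps + 2) * suc m            ∎)
  where
  open TwoValued shape inRange covers
  open ≤-Reasoning
  k = length rest
  m = edgeCount (4 + k)
  growth : ∀ k → (4 + k + 2) * suc (4 + k + (4 + k) + 4)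
                 ≡ 3 * ((4 + k + (4 + k) + 4) + (4 + k + (4 + k) + 4)) + suc (5 + 13 * k + 2 * (k * k))
  growth = solve-∀

splitWord : ∀ n (L : List ℕ) → length L ≡ edgeCount n →
  ∃ λ ps → ∃ λ e₁ → ∃ λ e₂ → ∃ λ e₃ → ∃ λ e₄ → length ps ≡ n × L ≡ labelWord ps e₁ e₂ e₃ e₄
splitWord zero    (e₁ ∷ e₂ ∷ e₃ ∷ e₄ ∷ []) refl = [] , e₁ , e₂ , e₃ , e₄ , refl , refl
splitWord (suc n) []                       ()
splitWord (suc n) (x ∷ [])                 eq with () ← trans (suc-injective eq) (cong (_+ 4) (+-suc n n))
splitWord (suc n) (x ∷ y ∷ L)              eq
  with ps , e₁ , e₂ , e₃ , e₄ , refl , refl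
         ← splitWord n L (suc-injective (trans (suc-injective eq) (cong (_+ 4) (+-suc n n))))
  = (x , y) ∷ ps , e₁ , e₂ , e₃ , e₄ , refl , refl

atLeastThreeValues : ∀ ps {e₁ e₂ e₃ e₄} → 1 ≤ length ps → ProperSums ps e₁ e₂ e₃ e₄ →
  InRange (edgeCount (length ps)) (labelWord ps e₁ e₂ e₃ e₄) →
  Covers (edgeCount (length ps)) (labelWord ps e₁ e₂ e₃ e₄) → Unique (labelWord ps e₁ e₂ e₃ e₄) →
  3 ≤ length (deduplicate _≟_ (vertexSums ps e₁ e₂ e₃ e₄))
atLeastThreeValues ((x , y) ∷ ps) {e₁} {e₂} {e₃} {e₄} _ proper inRange covers unique
  with 3 ≤? length (deduplicate _≟_ (vertexSums ((x , y) ∷ ps) e₁ e₂ e₃ e₄))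
... | yes three = three
... | no  few with a≢b , shape ← twoValues⇒sumPattern x y ps e₁ e₂ e₃ e₄ proper few
  = ⊥-elim (twoValued-impossible ((x , y) ∷ ps) (s≤s z≤n) a≢b shape inRange covers unique)

lowerBound : ∀ n (F : Labeling (Θ n)) → 1 ≤ n → LocalAntimagic (Θ n) F → 3 ≤ colorNumber (Θ n) F
lowerBound n F 1≤n la
  with ps , e₁ , e₂ , e₃ , e₄ , refl , word
         ← splitWord n (labelList (Θ n) F) (trans (length-tabulate (label (Θ n) F)) (edgeCount-Θ n))
  = subst (3 ≤_) (sym (colorNumber-Θ F word)) (atLeastThreeValues ps 1≤n (localAntimagic⇒properSums F word la)
      (subst₂ InRange (edgeCount-Θ n) word (labelList-inRange (Θ n) F))
      (subst₂ Covers (edgeCount-Θ n) word (labelList-covers (Θ n) F))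
      (subst Unique word (labelList-unique (Θ n) F)))

-- Three vertex sums suffice

-- The strict bounds b < a and c < a, rather than a ≢ b and a ≢ c, are what extend preserves.
record ThreeColourWord (n : ℕ) : Set where
  field
    ps          : List (ℕ × ℕ)
    e₁ e₂ e₃ e₄ : ℕ
    a c         : ℕ
    length-ps   : length ps ≡ n
    shape       : SumPattern ps e₁ e₂ e₃ e₄ a (suc (edgeCount n)) c
    b<a         : suc (edgeCount n) < a
    c<a         : c < a
    b≢c         : suc (edgeCount n) ≢ c
    inRange     : InRange (edgeCount n) (labelWord ps e₁ e₂ e₃ e₄)
    covers      : Covers (edgeCount n) (labelWord ps e₁ e₂ e₃ e₄)

upperBound : ∀ n → ThreeColourWord n → Σ (Labeling (Θ n)) λ F → LocalAntimagic (Θ n) F × colorNumber (Θ n) F ≡ 3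
upperBound _ record { ps = ps ; e₁ = e₁ ; e₂ = e₂ ; e₃ = e₃ ; e₄ = e₄ ; a = a ; c = c ; length-ps = refl
                    ; shape = shape ; b<a = b<a ; c<a = c<a ; b≢c = b≢c ; inRange = inRange ; covers = covers } =
  F , properSums⇒localAntimagic F word (shape⇒properSums shape a≢b b≢c) ,
  trans (colorNumber-Θ F word)
    (≤-antisym (length-deduplicate≤ V (a ∷ b ∷ c ∷ []) (vertexSums-values shape))
               (3≤length-deduplicate V (here (sym hub₀)) (onPath (here (sym left))) (onPath (there (here (sym middle))))
                 a≢b (>⇒≢ c<a) b≢c))
  where
  open SumPattern shape using (hub₀; left; middle)
  n = length ps
  b = suc (edgeCount n)
  V = vertexSums ps e₁ e₂ e₃ e₄
  a≢b : a ≢ b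
  a≢b = >⇒≢ b<a
  onPath : ∀ {w} → w ∈ (e₁ + e₂) ∷ (e₂ + e₃) ∷ (e₃ + e₄) ∷ [] → w ∈ V
  onPath w∈ = there (there (∈-++⁺ʳ (pairSums ps) w∈))
  labeling : Σ (Labeling (Θ n)) λ F → labelList (Θ n) F ≡ labelWord ps e₁ e₂ e₃ e₄
  labeling = labelingOf (Θ n) (labelWord ps e₁ e₂ e₃ e₄) (trans (length-labelWord ps e₁ e₂ e₃ e₄) (sym (edgeCount-Θ n)))
    (subst (λ m → InRange m (labelWord ps e₁ e₂ e₃ e₄)) (sym (edgeCount-Θ n)) inRange)
    (subst (λ m → Covers m (labelWord ps e₁ e₂ e₃ e₄)) (sym (edgeCount-Θ n)) covers)
  F = proj₁ labeling
  word = proj₂ labeling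

checkedWord : ∀ ps e₁ e₂ e₃ e₄ a c → SumPattern ps e₁ e₂ e₃ e₄ a (suc (edgeCount (length ps))) c →
  let m = edgeCount (length ps) ; L = labelWord ps e₁ e₂ e₃ e₄ in
  {True (suc m <? a ×-dec c <? a ×-dec ¬? (suc m ≟ c) ×-dec inRange? m L ×-dec All.all? (_∈? L) (applyUpTo suc m))} →
  ThreeColourWord (length ps)
checkedWord ps e₁ e₂ e₃ e₄ a c shape {checks} with b<a , c<a , b≢c , inRange , all∈ ← toWitness checks = record
  { ps = ps ; e₁ = e₁ ; e₂ = e₂ ; e₃ = e₃ ; e₄ = e₄ ; a = a ; c = c ; length-ps = refl ; shape = shape
  ; b<a = b<a ; c<a = c<a ; b≢c = b≢c ; inRange = inRange ; covers = covers-from-all all∈ }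

word₁ : ThreeColourWord 1
word₁ = checkedWord ((3 , 4) ∷ []) 6 1 2 5 9 3
  record { spokes = refl ∷ [] ; left = refl ; right = refl ; middle = refl ; hub₀ = refl ; hub₁ = refl }

word₂ : ThreeColourWord 2
word₂ = checkedWord ((1 , 8) ∷ (7 , 2) ∷ []) 6 3 5 4 14 8
  record { spokes = refl ∷ refl ∷ [] ; left = refl ; right = refl ; middle = refl ; hub₀ = refl ; hub₁ = refl }

word₃ : ThreeColourWord 3
word₃ = checkedWord ((3 , 8) ∷ (7 , 4) ∷ (6 , 5) ∷ []) 10 1 2 9 26 3
  record { spokes = refl ∷ refl ∷ refl ∷ [] ; left = refl ; right = refl ; middle = refl ; hub₀ = refl ; hub₁ = refl }

word₄ : ThreeColourWord 4
word₄ = checkedWord ((3 , 10) ∷ (4 , 9) ∷ (8 , 5) ∷ (6 , 7) ∷ []) 12 1 11 2 33 12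
  record { spokes = refl ∷ refl ∷ refl ∷ refl ∷ []
         ; left = refl ; right = refl ; middle = refl ; hub₀ = refl ; hub₁ = refl }

shift : ℕ × ℕ → ℕ × ℕ
shift (p , q) = 4 + p , 4 + q

block : ℕ → List (ℕ × ℕ)
block m = (1 , 8 + m) ∷ (7 + m , 2) ∷ (6 + m , 3) ∷ (4 , 5 + m) ∷ []

shift-sum : ∀ p q → (4 + p) + (4 + q) ≡ 8 + (p + q)
shift-sum = solve-∀

unpair-shift : ∀ ps ls → unpair (map shift ps) ++ map (4 +_) ls ≡ map (4 +_) (unpair ps ++ ls)
unpair-shift []             ls = refl
unpair-shift ((p , q) ∷ ps) ls = cong (λ l → 4 + p ∷ 4 + q ∷ l) (unpair-shift ps ls)

sum-shift : ∀ (π : ℕ × ℕ → ℕ) → (∀ p → π (shift p) ≡ 4 + π p) → ∀ ps →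
  sum (map π (map shift ps)) ≡ length ps * 4 + sum (map π ps)
sum-shift π π-shift ps = begin
  sum (map π (map shift ps))     ≡⟨ cong sum (trans (sym (map-∘ ps)) (trans (map-cong π-shift ps) (map-∘ ps))) ⟩
  sum (map (4 +_) (map π ps))    ≡⟨ sum-map-+ 4 (map π ps) ⟩
  length (map π ps) * 4 + sum (map π ps) ≡⟨ cong (λ l → l * 4 + sum (map π ps)) (length-map π ps) ⟩
  length ps * 4 + sum (map π ps) ∎
  where open ≡-Reasoning

edgeCount-step : ∀ n → edgeCount (4 + n) ≡ 8 + edgeCount n
edgeCount-step = expand
  where
  expand : ∀ n → (4 + n) + (4 + n) + 4 ≡ 8 + (n + n + 4)
  expand = solve-∀

block-inRange : ∀ m → InRange (8 + m) (unpair (block m))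
block-inRange m = low 1 ∷ high 8 ∷ high 7 ∷ low 2 ∷ high 6 ∷ low 3 ∷ low 4 ∷ high 5 ∷ []
  where
  low : ∀ k {1≤k : True (1 ≤? k)} {k≤8 : True (k ≤? 8)} → 1 ≤ k × k ≤ 8 + m
  low k {1≤k} {k≤8} = toWitness 1≤k , ≤-trans (toWitness k≤8) (m≤m+n 8 m)
  high : ∀ k {1≤k : True (1 ≤? k)} {k≤8 : True (k ≤? 8)} → 1 ≤ k + m × k + m ≤ 8 + m
  high k {1≤k} {k≤8} = ≤-trans (toWitness 1≤k) (m≤m+n k m) , +-monoˡ-≤ m (toWitness k≤8)

block-covers : ∀ m t → 1 ≤ t → t ≤ 4 → t ∈ unpair (block m) × t + (4 + m) ∈ unpair (block m)
block-covers m 1 _ _ = here refl , there (there (there (there (there (there (there (here refl)))))))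
block-covers m 2 _ _ = there (there (there (here refl))) , there (there (there (there (here refl))))
block-covers m 3 _ _ = there (there (there (there (there (here refl))))) , there (there (here refl))
block-covers m 4 _ _ = there (there (there (there (there (there (here refl)))))) , there (here refl)
block-covers m (suc (suc (suc (suc (suc _))))) _ (s≤s (s≤s (s≤s (s≤s ()))))

covers-extend : ∀ {m L B} → Covers m L → (∀ t → 1 ≤ t → t ≤ 4 → t ∈ B × t + (4 + m) ∈ B) →
  Covers (8 + m) (B ++ map (4 +_) L)
covers-extend {m} {L} {B} covers block j 1≤j j≤8+m with j ≤? 4
... | yes j≤4 = ∈-++⁺ˡ (proj₁ (block j 1≤j j≤4))
... | no  j≰4 with j ≤? 4 + m
...   | yes j≤4+m = ∈-++⁺ʳ B (subst (_∈ map (4 +_) L) (m+[n∸m]≡n (<⇒≤ (≰⇒> j≰4)))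
                      (∈-map⁺ (4 +_) (covers (j ∸ 4) (m<n⇒0<n∸m (≰⇒> j≰4)) (∸-monoˡ-≤ 4 j≤4+m))))
...   | no  j≰4+m = subst (_∈ B ++ map (4 +_) L) (m∸n+n≡m (<⇒≤ (≰⇒> j≰4+m)))
                      (∈-++⁺ˡ (proj₂ (block (j ∸ (4 + m)) (m<n⇒0<n∸m (≰⇒> j≰4+m)) t≤4)))
  where
  t≤4 : j ∸ (4 + m) ≤ 4
  t≤4 = subst (j ∸ (4 + m) ≤_) (m+n∸n≡m 4 m) (∸-monoˡ-≤ (4 + m) j≤8+m)

hubGrowth : ℕ → ℕ
hubGrowth n = 22 + (edgeCount n + edgeCount n) + n * 4

extend-shape : ∀ {ps e₁ e₂ e₃ e₄ a c} → SumPattern ps e₁ e₂ e₃ e₄ a (suc (edgeCount (length ps))) c →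
  SumPattern (block (edgeCount (length ps)) ++ map shift ps) (4 + e₁) (4 + e₂) (4 + e₃) (4 + e₄)
             (hubGrowth (length ps) + a) (9 + edgeCount (length ps)) (8 + c)
extend-shape {ps} {e₁} {e₂} {e₃} {e₄} {a} shape = record
  { spokes = ++⁺ (refl ∷ +-comm (7 + m) 2 ∷ +-comm (6 + m) 3 ∷ refl ∷ [])
                 (map⁺ (All.map (λ {p} p-sum → trans (shift-sum (proj₁ p) (proj₂ p)) (cong (8 +_) p-sum)) spokes))
  ; left   = trans (shift-sum e₁ e₂) (cong (8 +_) left)
  ; right  = trans (shift-sum e₃ e₄) (cong (8 +_) right)
  ; middle = trans (shift-sum e₂ e₃) (cong (8 +_) middle)
  ; hub₀   = trans (cong (λ S → 1 + ((7 + m) + ((6 + m) + (4 + S))) + (4 + e₁)) (sum-shift proj₁ (λ _ → refl) ps))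
                   (trans (growth₀ m n (sum (map proj₁ ps)) e₁) (cong (hubGrowth n +_) hub₀))
  ; hub₁   = trans (cong (λ S → (8 + m) + (2 + (3 + ((5 + m) + S))) + (4 + e₄)) (sum-shift proj₂ (λ _ → refl) ps))
                   (trans (growth₁ m n (sum (map proj₂ ps)) e₄) (cong (hubGrowth n +_) hub₁))
  }
  where
  open SumPattern shape
  n = length ps
  m = edgeCount n
  growth₀ : ∀ m l S e → 1 + ((7 + m) + ((6 + m) + (4 + (l * 4 + S)))) + (4 + e) ≡ (22 + (m + m) + l * 4) + (S + e)
  growth₀ = solve-∀
  growth₁ : ∀ m l S e → (8 + m) + (2 + (3 + ((5 + m) + (l * 4 + S)))) + (4 + e) ≡ (22 + (m + m) + l * 4) + (S + e)
  growth₁ = solve-∀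

extend : ∀ {n} → ThreeColourWord n → ThreeColourWord (4 + n)
extend record { ps = ps ; e₁ = e₁ ; e₂ = e₂ ; e₃ = e₃ ; e₄ = e₄ ; a = a ; c = c ; length-ps = refl
              ; shape = shape ; b<a = b<a ; c<a = c<a ; b≢c = b≢c ; inRange = inRange ; covers = covers } = record
  { ps        = ps′
  ; e₁ = 4 + e₁ ; e₂ = 4 + e₂ ; e₃ = 4 + e₃ ; e₄ = 4 + e₄
  ; a         = K + a
  ; c         = 8 + c
  ; length-ps = cong (4 +_) (length-map shift ps)
  ; shape     = subst (λ b → SumPattern ps′ (4 + e₁) (4 + e₂) (4 + e₃) (4 + e₄) (K + a) b (8 + c)) b≡ (extend-shape shape)
  ; b<a       = subst (_< K + a) b≡ (+-mono-≤-< 8≤K b<a)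
  ; c<a       = +-mono-≤-< 8≤K c<a
  ; b≢c       = subst (_≢ 8 + c) b≡ (b≢c ∘ +-cancelˡ-≡ 8 _ _)
  ; inRange   = subst₂ InRange (sym (edgeCount-step n)) word
                  (++⁺ (block-inRange m) (map⁺ (All.map shifted inRange)))
  ; covers    = subst₂ Covers (sym (edgeCount-step n)) word (covers-extend covers (block-covers m))
  }
  where
  n = length ps
  m = edgeCount n
  K = hubGrowth n
  ps′ = block m ++ map shift ps
  8≤K : 8 ≤ K
  8≤K = ≤-trans (m≤m+n 8 (14 + (m + m))) (m≤m+n (22 + (m + m)) (n * 4))
  b≡ : 9 + m ≡ suc (edgeCount (4 + n))
  b≡ = cong suc (sym (edgeCount-step n))
  shifted : ∀ {x} → 1 ≤ x × x ≤ m → 1 ≤ 4 + x × 4 + x ≤ 8 + m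
  shifted (1≤x , x≤m) = ≤-trans 1≤x (m≤n+m _ 4) , +-mono-≤ (m≤m+n 4 4) x≤m
  word : unpair (block m) ++ map (4 +_) (labelWord ps e₁ e₂ e₃ e₄) ≡ labelWord ps′ (4 + e₁) (4 + e₂) (4 + e₃) (4 + e₄)
  word = cong (unpair (block m) ++_) (sym (unpair-shift ps (e₁ ∷ e₂ ∷ e₃ ∷ e₄ ∷ [])))

threeColourWord : ∀ n → ThreeColourWord (suc n)
threeColourWord 0                         = word₁
threeColourWord 1                         = word₂
threeColourWord 2                         = word₃
threeColourWord 3                         = word₄
threeColourWord (suc (suc (suc (suc n)))) = extend (threeColourWord n)

theorem2p2 : (s : ℕ) → 2 ≤ s → χla≡ (θ (replicate (s ∸ 1) 2 ++ (4 ∷ []))) 3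
theorem2p2 (suc zero) (s≤s ())
theorem2p2 (suc (suc n)) _ = upperBound (suc n) (threeColourWord n) , λ F → lowerBound (suc n) F (s≤s z≤n)
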